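{- Fix $\epsilon>0$. Let $\mathcal{J}$ be a finite set of jobs with positive integer processing times $p_j$ and nondecreasing cost functions $f_j:\{1,\dots,T\}\to\mathbb{Z}_{\ge0}$, where $T=\sum_jp_j$, $\mathcal{T}=\{1,\dots,T\}$ and $D(t)=T-t+1$. Let $\widehat{\mathcal{T}}=\{t_1<\dots<t_\tau\}$ and $f'_j$ be as defined in the context, and consider the integer programs (IP): minimize $\sum_j\sum_{t\in\mathcal{T}}f_j(t)x_{jt}$ subject to $\sum_j\sum_{s\in\mathcal{T}:s\ge t}p_jx_{js}\ge D(t)$ for all $t\in\mathcal{T}$, $\sum_{t\in\mathcal{T}}x_{jt}=1$ for all $j$, $x_{jt}\in\{0,1\}$; (IP$'$): minimize $\sum_j\sum_{t\in\widehat{\mathcal{T}}}f'_j(t)x'_{jt}$ subject to $\sum_j\sum_{s\in\widehat{\mathcal{T}}:s\ge t}p_jx'_{js}\ge D(t)$ for all $t\in\widehat{\mathcal{T}}$, $\sum_{t\in\widehat{\mathcal{T}}}x'_{jt}=1$ for all $j$, $x'_{jt}\in\{0,1\}$. For any feasible solution $x'$ of (IP$'$) there exists a feasible solution $x$ of (IP) with the same objective value.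
   Context: For each job $j$ let $I^0_j=\{t\in\mathcal{T}: f_j(t)=0\}$ and, for $k\ge1$, $I^k_j=\{t\in\mathcal{T}:(1+\epsilon)^{k-1}\le f_j(t)<(1+\epsilon)^k\}$; let $\widehat{\mathcal{T}}_j$ be the set of minimum elements of the nonempty $I^k_j$, and $\widehat{\mathcal{T}}=\{1\}\cup\bigcup_j\widehat{\mathcal{T}}_j=\{t_1<\dots<t_\tau\}$ (so $t_1=1$). Set $t_{\tau+1}=T+1$. The modified costs are $f'_j(t_i)=f_j(t_{i+1}-1)$ for $i=1,\dots,\tau$.
   Formalization: The accuracy parameter ε ranges over the positive rationals, and the bucket bounds defining the sets $I^k_j$ are compared in ℚ. -}

module Defs where

open import Data.Nat using (ℕ; zero; suc; _+_; _*_; _∸_; _≤_; _<_; _≥_; _≤ᵇ_)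
open import Data.Fin using (Fin; toℕ) renaming (zero to fzero; suc to fsuc)
open import Data.Bool using (if_then_else_)
open import Data.Integer using (+_)
open import Data.Product using (Σ; ∃; _×_)
open import Data.Sum using (_⊎_)
open import Relation.Binary.PropositionalEquality using (_≡_)
open import Relation.Nullary using (¬_)
import Data.Rational as Q
open Q using (ℚ)

Σᶠ : (n : ℕ) → (Fin n → ℕ) → ℕ
Σᶠ zero    g = 0
Σᶠ (suc n) g = g fzero + Σᶠ n (λ i → g (fsuc i))

sumCount : ℕ → ℕ → (ℕ → ℕ) → ℕ
sumCount a zero    g = 0
sumCount a (suc k) g = g a + sumCount (suc a) k g

-- ΣFT a b g = Σ_{s = a}^{b} g s   (empty if b < a)
ΣFT : ℕ → ℕ → (ℕ → ℕ) → ℕ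
ΣFT a b g = sumCount a (suc b ∸ a) g

ℕ→ℚ : ℕ → ℚ
ℕ→ℚ n = + n Q./ 1

_^Q_ : ℚ → ℕ → ℚ
q ^Q zero  = Q.1ℚ
q ^Q suc k = q Q.* (q ^Q k)

InI : ℚ → (ℕ → ℕ) → ℕ → ℕ → Set
InI ε fj zero    t = fj t ≡ 0
InI ε fj (suc k) t =
  ((Q.1ℚ Q.+ ε) ^Q k Q.≤ ℕ→ℚ (fj t)) × (ℕ→ℚ (fj t) Q.< (Q.1ℚ Q.+ ε) ^Q suc k)

IsMinOfSomeI : ℚ → ℕ → (ℕ → ℕ) → ℕ → Set
IsMinOfSomeI ε T fj t =
  (1 ≤ t) × (t ≤ T) × ∃ λ k → InI ε fj k t ×
    ((s : ℕ) → 1 ≤ s → s < t → ¬ InI ε fj k s)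

-- t_{i+1} for i : Fin τ, with t_{τ+1} = T + 1

nextT : {τ : ℕ} → (Fin τ → ℕ) → ℕ → Fin τ → ℕ
nextT {suc zero}    t T fzero    = suc T
nextT {suc (suc m)} t T fzero    = t (fsuc fzero)
nextT {suc (suc m)} t T (fsuc i) = nextT {suc m} (λ k → t (fsuc k)) T i

-- modified costs f'_j(t_i) = f_j(t_{i+1} - 1)
f′ : {n τ : ℕ} → (Fin n → ℕ → ℕ) → (Fin τ → ℕ) → ℕ → Fin n → Fin τ → ℕ
f′ f t T j i = f j (nextT t T i ∸ 1)

IPFeasible : (n : ℕ) → (Fin n → ℕ) → ℕ → (Fin n → ℕ → ℕ) → Set
IPFeasible n p T x =
  ((t : ℕ) → 1 ≤ t → t ≤ T →
     Σᶠ n (λ j → ΣFT t T (λ s → p j * x j s)) ≥ (T + 1 ∸ t))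
  × ((j : Fin n) → ΣFT 1 T (λ t → x j t) ≡ 1)
  × ((j : Fin n) (t : ℕ) → 1 ≤ t → t ≤ T → (x j t ≡ 0 ⊎ x j t ≡ 1))

IPObj : (n : ℕ) → ℕ → (Fin n → ℕ → ℕ) → (Fin n → ℕ → ℕ) → ℕ
IPObj n T f x = Σᶠ n (λ j → ΣFT 1 T (λ t → f j t * x j t))

-- (IP'): x' j i is the variable x'_{j t_i}
IP′Feasible : (n : ℕ) → (Fin n → ℕ) → ℕ → (τ : ℕ) → (Fin τ → ℕ) →
              (Fin n → Fin τ → ℕ) → Set
IP′Feasible n p T τ t x′ =
  ((i : Fin τ) →
     Σᶠ n (λ j → Σᶠ τ (λ i′ → if toℕ i ≤ᵇ toℕ i′ then p j * x′ j i′ else 0))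
       ≥ (T + 1 ∸ t i))
  × ((j : Fin n) → Σᶠ τ (λ i → x′ j i) ≡ 1)
  × ((j : Fin n) (i : Fin τ) → (x′ j i ≡ 0 ⊎ x′ j i ≡ 1))

IP′Obj : (n : ℕ) → ℕ → (τ : ℕ) → (Fin τ → ℕ) → (Fin n → ℕ → ℕ) →
         (Fin n → Fin τ → ℕ) → ℕ
IP′Obj n T τ t f x′ = Σᶠ n (λ j → Σᶠ τ (λ i → f′ f t T j i * x′ j i))

-- Job j scheduled by x′ at the breakpoint tᵢ is scheduled by x at the last time t_{i+1} − 1
-- before the next breakpoint, which is exactly the time at which f′ charges it, so the
-- objectives agree term by term.  Demand constraints survive because every s ∈ 𝒯 lies in a
-- block tᵢ ≤ s < t_{i+1}: the constraint of (IP′) at tᵢ already covers D(tᵢ) ≥ D(s), and all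
-- jobs counted there (those placed at some t_{i′} with i′ ≥ i) now run at t_{i′+1} − 1 ≥ s.
module Submission where

open import Defs
open import Data.Nat using (ℕ; zero; suc; _+_; _*_; _∸_; _≤_; _<_; _≥_; _≤ᵇ_; z≤n; s≤s; _≤?_; _≟_)
open import Data.Nat.Properties
open import Algebra.Properties.CommutativeSemigroup +-commutativeSemigroup using (interchange)
open import Data.Fin using (Fin; toℕ) renaming (zero to fzero; suc to fsuc)
open import Data.Fin.Properties using (toℕ-injective; toℕ<n)
open import Data.Product using (∃; _×_; _,_; proj₁; proj₂)
open import Data.Sum using (_⊎_; inj₁; inj₂)
open import Data.Bool using (true; false; if_then_else_) renaming (T to True)
open import Data.Empty using (⊥-elim)
open import Relation.Nullary using (yes; no)
open import Relation.Binary.PropositionalEquality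
open import Function.Bundles using (_⇔_; Equivalence)
import Data.Rational as Q

Σᶠ-cong : ∀ n {g h : Fin n → ℕ} → (∀ i → g i ≡ h i) → Σᶠ n g ≡ Σᶠ n h
Σᶠ-cong zero    g≡h = refl
Σᶠ-cong (suc n) g≡h = cong₂ _+_ (g≡h fzero) (Σᶠ-cong n (λ i → g≡h (fsuc i)))

Σᶠ-mono-≤ : ∀ n {g h : Fin n → ℕ} → (∀ i → g i ≤ h i) → Σᶠ n g ≤ Σᶠ n h
Σᶠ-mono-≤ zero    g≤h = z≤n
Σᶠ-mono-≤ (suc n) g≤h = +-mono-≤ (g≤h fzero) (Σᶠ-mono-≤ n (λ i → g≤h (fsuc i)))

Σᶠ-zero : ∀ n → Σᶠ n (λ _ → 0) ≡ 0
Σᶠ-zero zero    = refl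
Σᶠ-zero (suc n) = Σᶠ-zero n

Σᶠ-distrib-+ : ∀ n (g h : Fin n → ℕ) → Σᶠ n (λ i → g i + h i) ≡ Σᶠ n g + Σᶠ n h
Σᶠ-distrib-+ zero    g h = refl
Σᶠ-distrib-+ (suc n) g h = begin
  (g fzero + h fzero) + Σᶠ n (λ i → g (fsuc i) + h (fsuc i))
    ≡⟨ cong (g fzero + h fzero +_) (Σᶠ-distrib-+ n (λ i → g (fsuc i)) (λ i → h (fsuc i))) ⟩
  (g fzero + h fzero) + (Σᶠ n (λ i → g (fsuc i)) + Σᶠ n (λ i → h (fsuc i)))
    ≡⟨ interchange (g fzero) (h fzero) _ _ ⟩
  Σᶠ (suc n) g + Σᶠ (suc n) h ∎
  where open ≡-Reasoning

*-distribˡ-Σᶠ : ∀ n c (g : Fin n → ℕ) → c * Σᶠ n g ≡ Σᶠ n (λ i → c * g i)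
*-distribˡ-Σᶠ zero    c g = *-zeroʳ c
*-distribˡ-Σᶠ (suc n) c g =
  trans (*-distribˡ-+ c (g fzero) _) (cong (c * g fzero +_) (*-distribˡ-Σᶠ n c (λ i → g (fsuc i))))

sumCount-cong : ∀ a k {g h : ℕ → ℕ} → (∀ s → g s ≡ h s) → sumCount a k g ≡ sumCount a k h
sumCount-cong a zero    g≡h = refl
sumCount-cong a (suc k) g≡h = cong₂ _+_ (g≡h a) (sumCount-cong (suc a) k g≡h)

sumCount-Σᶠ-comm : ∀ τ a k (G : ℕ → Fin τ → ℕ) →
  sumCount a k (λ s → Σᶠ τ (G s)) ≡ Σᶠ τ (λ i → sumCount a k (λ s → G s i))
sumCount-Σᶠ-comm τ a zero    G = sym (Σᶠ-zero τ)
sumCount-Σᶠ-comm τ a (suc k) G =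
  trans (cong (Σᶠ τ (G a) +_) (sumCount-Σᶠ-comm τ (suc a) k G))
        (sym (Σᶠ-distrib-+ τ (G a) (λ i → sumCount (suc a) k (λ s → G s i))))

sumCount-vanish : ∀ a k (g : ℕ → ℕ) → (∀ s → a ≤ s → g s ≡ 0) → sumCount a k g ≡ 0
sumCount-vanish a zero    g g≡0 = refl
sumCount-vanish a (suc k) g g≡0 =
  cong₂ _+_ (g≡0 a ≤-refl) (sumCount-vanish (suc a) k g (λ s a<s → g≡0 s (<⇒≤ a<s)))

sumCount-single : ∀ a k (g : ℕ → ℕ) q → a ≤ q → q < a + k →
  (∀ s → s ≢ q → g s ≡ 0) → sumCount a k g ≡ g q
sumCount-single a zero g q a≤q q<a+0 g≡0 =
  ⊥-elim (<⇒≱ q<a+0 (subst (_≤ q) (sym (+-identityʳ a)) a≤q))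
sumCount-single a (suc k) g q a≤q q<a+k g≡0 with a ≟ q
... | yes refl =
  trans (cong (g a +_) (sumCount-vanish (suc a) k g (λ s a<s → g≡0 s (>⇒≢ a<s)))) (+-identityʳ (g a))
... | no a≢q =
  trans (cong (_+ sumCount (suc a) k g) (g≡0 a a≢q))
        (sumCount-single (suc a) k g q (≤∧≢⇒< a≤q a≢q) (subst (q <_) (+-suc a k) q<a+k) g≡0)

ΣFT-single : ∀ a b (g : ℕ → ℕ) q → a ≤ q → q ≤ b → (∀ s → s ≢ q → g s ≡ 0) → ΣFT a b g ≡ g q
ΣFT-single a b g q a≤q q≤b =
  sumCount-single a (suc b ∸ a) g q a≤q
    (subst (q <_) (sym (m+[n∸m]≡n (≤-trans a≤q (m≤n⇒m≤1+n q≤b)))) (s≤s q≤b))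

δ : ℕ → ℕ → ℕ → ℕ
δ q v s with q ≟ s
... | yes _ = v
... | no  _ = 0

δ-≤ : ∀ q v s → δ q v s ≤ v
δ-≤ q v s with q ≟ s
... | yes _ = ≤-refl
... | no  _ = z≤n

*-δ-off : ∀ c q v s → s ≢ q → c * δ q v s ≡ 0
*-δ-off c q v s s≢q with q ≟ s
... | yes q≡s = ⊥-elim (s≢q (sym q≡s))
... | no  _   = *-zeroʳ c

δ-diag : ∀ q v → δ q v q ≡ v
δ-diag q v with q ≟ q
... | yes _   = refl
... | no  q≢q = ⊥-elim (q≢q refl)

ΣFT-*δ : ∀ (c : ℕ → ℕ) a b q v → a ≤ q → q ≤ b → ΣFT a b (λ s → c s * δ q v s) ≡ c q * v
ΣFT-*δ c a b q v a≤q q≤b =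
  trans (ΣFT-single a b (λ s → c s * δ q v s) q a≤q q≤b (λ s → *-δ-off (c s) q v s))
        (cong (c q *_) (δ-diag q v))

spread : ∀ {τ} → (Fin τ → ℕ) → (Fin τ → ℕ) → ℕ → ℕ
spread {τ} pos y s = Σᶠ τ (λ i → δ (pos i) (y i) s)

ΣFT-*spread : ∀ {τ} (pos y : Fin τ → ℕ) (c : ℕ → ℕ) a b →
  ΣFT a b (λ s → c s * spread pos y s) ≡ Σᶠ τ (λ i → ΣFT a b (λ s → c s * δ (pos i) (y i) s))
ΣFT-*spread {τ} pos y c a b =
  trans (sumCount-cong a (suc b ∸ a) (λ s → *-distribˡ-Σᶠ τ (c s) (λ i → δ (pos i) (y i) s)))
        (sumCount-Σᶠ-comm τ a (suc b ∸ a) (λ s i → c s * δ (pos i) (y i) s))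

ΣFT-*spread-within : ∀ {τ} (pos y : Fin τ → ℕ) (c : ℕ → ℕ) a b →
  (∀ i → a ≤ pos i × pos i ≤ b) →
  ΣFT a b (λ s → c s * spread pos y s) ≡ Σᶠ τ (λ i → c (pos i) * y i)
ΣFT-*spread-within {τ} pos y c a b within =
  trans (ΣFT-*spread pos y c a b)
        (Σᶠ-cong τ (λ i → ΣFT-*δ c a b (pos i) (y i) (proj₁ (within i)) (proj₂ (within i))))

spread-≤-Σᶠ : ∀ {τ} (pos y : Fin τ → ℕ) s → spread pos y s ≤ Σᶠ τ y
spread-≤-Σᶠ {τ} pos y s = Σᶠ-mono-≤ τ (λ i → δ-≤ (pos i) (y i) s)

≤1⇒≡0⊎≡1 : ∀ {x} → x ≤ 1 → x ≡ 0 ⊎ x ≡ 1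
≤1⇒≡0⊎≡1 z≤n       = inj₁ refl
≤1⇒≡0⊎≡1 (s≤s z≤n) = inj₂ refl

nextT-cases : ∀ {τ} (t : Fin τ → ℕ) T (i : Fin τ) →
  (suc (toℕ i) ≡ τ × nextT t T i ≡ suc T) ⊎ (∃ λ k → toℕ k ≡ suc (toℕ i) × nextT t T i ≡ t k)
nextT-cases {suc zero}    t T fzero    = inj₁ (refl , refl)
nextT-cases {suc (suc m)} t T fzero    = inj₂ (fsuc fzero , refl , refl)
nextT-cases {suc (suc m)} t T (fsuc i) with nextT-cases (λ k → t (fsuc k)) T i
... | inj₁ (last , next≡) = inj₁ (cong suc last , next≡)
... | inj₂ (k , k≡ , next≡) = inj₂ (fsuc k , cong suc k≡ , next≡)

block-containing : ∀ {τ} (t : Fin (suc τ) → ℕ) T s → t fzero ≤ s → s ≤ T →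
  ∃ λ i → t i ≤ s × s < nextT t T i
block-containing {zero}  t T s t₀≤s s≤T = fzero , t₀≤s , s≤s s≤T
block-containing {suc τ} t T s t₀≤s s≤T with t (fsuc fzero) ≤? s
... | yes t₁≤s with block-containing (λ k → t (fsuc k)) T s t₁≤s s≤T
...   | i , tᵢ≤s , s<next = fsuc i , tᵢ≤s , s<next
block-containing {suc τ} t T s t₀≤s s≤T | no t₁≰s = fzero , t₀≤s , ≰⇒> t₁≰s

module Breakpoints {τ : ℕ} (t : Fin τ → ℕ) (T : ℕ)
  (increasing : ∀ i k → toℕ i < toℕ k → t i < t k) (bounded : ∀ i → t i ≤ T) where

  <-nextT : ∀ i → t i < nextT t T i
  <-nextT i with nextT-cases t T i
  ... | inj₁ (_ , next≡) = subst (t i <_) (sym next≡) (s≤s (bounded i))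
  ... | inj₂ (k , k≡ , next≡) = subst (t i <_) (sym next≡) (increasing i k (≤-reflexive (sym k≡)))

  nextT-≤ : ∀ i k → toℕ i < toℕ k → nextT t T i ≤ t k
  nextT-≤ i k i<k with nextT-cases t T i
  ... | inj₁ (last , _) = ⊥-elim (<⇒≱ (toℕ<n k) (subst (_≤ toℕ k) last i<k))
  ... | inj₂ (k′ , k′≡ , next≡) with m≤n⇒m<n∨m≡n (subst (_≤ toℕ k) (sym k′≡) i<k)
  ...   | inj₁ k′<k = subst (_≤ t k) (sym next≡) (<⇒≤ (increasing k′ k k′<k))
  ...   | inj₂ k′≡k = subst (_≤ t k) (sym next≡) (≤-reflexive (cong t (toℕ-injective k′≡k)))

  nextT-≤-1+T : ∀ i → nextT t T i ≤ suc T
  nextT-≤-1+T i with nextT-cases t T i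
  ... | inj₁ (_ , next≡) = ≤-reflexive next≡
  ... | inj₂ (k , _ , next≡) = subst (_≤ suc T) (sym next≡) (m≤n⇒m≤1+n (bounded k))

  nextT-mono-< : ∀ i i′ s → toℕ i ≤ toℕ i′ → s < nextT t T i → s < nextT t T i′
  nextT-mono-< i i′ s i≤i′ s<next with m≤n⇒m<n∨m≡n i≤i′
  ... | inj₁ i<i′ = <-trans (≤-trans s<next (nextT-≤ i i′ i<i′)) (<-nextT i′)
  ... | inj₂ i≡i′ = subst (λ k → s < nextT t T k) (toℕ-injective i≡i′) s<next

  lastBefore : Fin τ → ℕ
  lastBefore i = nextT t T i ∸ 1

  <⇒≤-lastBefore : ∀ {s} i → s < nextT t T i → s ≤ lastBefore i
  <⇒≤-lastBefore i s<next = ∸-monoˡ-≤ 1 s<next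

  lastBefore-≤ : ∀ i → lastBefore i ≤ T
  lastBefore-≤ i = ∸-monoˡ-≤ 1 (nextT-≤-1+T i)

  lastBefore-≥ : ∀ i → t i ≤ lastBefore i
  lastBefore-≥ i = <⇒≤-lastBefore i (<-nextT i)

module Placement {n τ : ℕ} (p : Fin n → ℕ) (T : ℕ) (t : Fin (suc τ) → ℕ)
  (increasing : ∀ i k → toℕ i < toℕ k → t i < t k)
  (in-𝒯 : ∀ i → 1 ≤ t i × t i ≤ T) (starts : t fzero ≤ 1) where

  open Breakpoints t T increasing (λ i → proj₂ (in-𝒯 i))

  place : (Fin n → Fin (suc τ) → ℕ) → Fin n → ℕ → ℕ
  place x′ j = spread lastBefore (x′ j)

  lastBefore-in-𝒯 : ∀ i → 1 ≤ lastBefore i × lastBefore i ≤ T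
  lastBefore-in-𝒯 i = ≤-trans (proj₁ (in-𝒯 i)) (lastBefore-≥ i) , lastBefore-≤ i

  ΣFT-*place : ∀ x′ j (c : ℕ → ℕ) →
    ΣFT 1 T (λ s → c s * place x′ j s) ≡ Σᶠ (suc τ) (λ i → c (lastBefore i) * x′ j i)
  ΣFT-*place x′ j c = ΣFT-*spread-within lastBefore (x′ j) c 1 T lastBefore-in-𝒯

  place-objective : ∀ f x′ → IPObj n T f (place x′) ≡ IP′Obj n T (suc τ) t f x′
  place-objective f x′ = Σᶠ-cong n (λ j → ΣFT-*place x′ j (f j))

  place-assignment : ∀ x′ j → Σᶠ (suc τ) (x′ j) ≡ 1 → ΣFT 1 T (place x′ j) ≡ 1
  place-assignment x′ j assigned = begin
    ΣFT 1 T (place x′ j)                        ≡⟨ sumCount-cong 1 T (λ s → sym (*-identityˡ _)) ⟩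
    ΣFT 1 T (λ s → 1 * place x′ j s)            ≡⟨ ΣFT-*place x′ j (λ _ → 1) ⟩
    Σᶠ (suc τ) (λ i → 1 * x′ j i)               ≡⟨ Σᶠ-cong (suc τ) (λ i → *-identityˡ (x′ j i)) ⟩
    Σᶠ (suc τ) (x′ j)                           ≡⟨ assigned ⟩
    1                                           ∎
    where open ≡-Reasoning

  place-binary : ∀ x′ j s → Σᶠ (suc τ) (x′ j) ≡ 1 → place x′ j s ≡ 0 ⊎ place x′ j s ≡ 1
  place-binary x′ j s assigned =
    ≤1⇒≡0⊎≡1 (subst (place x′ j s ≤_) assigned (spread-≤-Σᶠ lastBefore (x′ j) s))

  demand-from-block : ∀ x′ j i s → s < nextT t T i →
    Σᶠ (suc τ) (λ i′ → if toℕ i ≤ᵇ toℕ i′ then p j * x′ j i′ else 0)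
      ≤ ΣFT s T (λ s′ → p j * place x′ j s′)
  demand-from-block x′ j i s s<next =
    subst (_ ≤_) (sym (ΣFT-*spread lastBefore (x′ j) (λ _ → p j) s T)) (Σᶠ-mono-≤ (suc τ) term)
    where
    term : ∀ i′ → (if toℕ i ≤ᵇ toℕ i′ then p j * x′ j i′ else 0)
                ≤ ΣFT s T (λ s′ → p j * δ (lastBefore i′) (x′ j i′) s′)
    term i′ with toℕ i ≤ᵇ toℕ i′ in i≤ᵇi′
    ... | false = z≤n
    ... | true  = ≤-reflexive (sym (ΣFT-*δ (λ _ → p j) s T (lastBefore i′) (x′ j i′)
        (<⇒≤-lastBefore i′ (nextT-mono-< i i′ s (≤ᵇ⇒≤ _ _ (subst True (sym i≤ᵇi′) _)) s<next))
        (lastBefore-≤ i′)))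

  place-feasible : ∀ x′ → IP′Feasible n p T (suc τ) t x′ → IPFeasible n p T (place x′)
  place-feasible x′ (demand′ , assigned , _) = demand , (λ j → place-assignment x′ j (assigned j)) , binary
    where
    demand : ∀ s → 1 ≤ s → s ≤ T → Σᶠ n (λ j → ΣFT s T (λ s′ → p j * place x′ j s′)) ≥ T + 1 ∸ s
    demand s 1≤s s≤T with block-containing t T s (≤-trans starts 1≤s) s≤T
    ... | i , tᵢ≤s , s<next =
      ≤-trans (∸-monoʳ-≤ (T + 1) tᵢ≤s)
              (≤-trans (demand′ i) (Σᶠ-mono-≤ n (λ j → demand-from-block x′ j i s s<next)))
    binary : ∀ j s → 1 ≤ s → s ≤ T → place x′ j s ≡ 0 ⊎ place x′ j s ≡ 1
    binary j s _ _ = place-binary x′ j s (assigned j)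

lemma10 : (ε : Q.ℚ) → Q.0ℚ Q.< ε →
    (n : ℕ) (p : Fin n → ℕ) → ((j : Fin n) → 0 < p j) →
    (T : ℕ) → T ≡ Σᶠ n p →
    (f : Fin n → ℕ → ℕ) →
    ((j : Fin n) (s t : ℕ) → 1 ≤ s → s ≤ t → t ≤ T → f j s ≤ f j t) →
    (τ : ℕ) (t : Fin τ → ℕ) →
    ((i k : Fin τ) → Data.Fin._<_ i k → t i < t k) →
    ((s : ℕ) → (∃ λ i → t i ≡ s) ⇔ (s ≡ 1 ⊎ ∃ λ j → IsMinOfSomeI ε T (f j) s)) →
    (x′ : Fin n → Fin τ → ℕ) → IP′Feasible n p T τ t x′ →
    ∃ λ (x : Fin n → ℕ → ℕ) →
      IPFeasible n p T x × IPObj n T f x ≡ IP′Obj n T τ t f x′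
lemma10 ε _ zero p _ T refl f _ τ t _ _ x′ _ =
  (λ _ _ → 0) , ((λ s 1≤s s≤0 → ⊥-elim (<⇒≱ 1≤s s≤0)) , (λ ()) , (λ ())) , refl
lemma10 ε _ (suc n) p _ T _ f _ zero t _ breakpoints x′ _
  with () , _ ← Equivalence.from (breakpoints 1) (inj₁ refl)
lemma10 ε _ (suc n) p p>0 T T≡Σp f _ (suc τ) t increasing breakpoints x′ feasible =
  place x′ , place-feasible x′ feasible , place-objective f x′
  where
  1≤T : 1 ≤ T
  1≤T = subst (1 ≤_) (sym T≡Σp) (≤-trans (p>0 fzero) (m≤m+n (p fzero) _))

  in-𝒯 : ∀ i → 1 ≤ t i × t i ≤ T
  in-𝒯 i with Equivalence.to (breakpoints (t i)) (i , refl)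
  ... | inj₁ tᵢ≡1 = ≤-reflexive (sym tᵢ≡1) , subst (_≤ T) (sym tᵢ≡1) 1≤T
  ... | inj₂ (_ , 1≤tᵢ , tᵢ≤T , _) = 1≤tᵢ , tᵢ≤T

  starts : t fzero ≤ 1
  starts with Equivalence.from (breakpoints 1) (inj₁ refl)
  ... | fzero  , t₀≡1 = ≤-reflexive t₀≡1
  ... | fsuc k , tₖ≡1 = subst (t fzero ≤_) tₖ≡1 (<⇒≤ (increasing fzero (fsuc k) (s≤s z≤n)))

  open Placement p T t increasing in-𝒯 starts
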